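{- Let $W$ be a finite Coxeter group with standard Coxeter element $c$ and $c$-compatible reflection ordering $\prec$. The quadratic dual $\mathcal{P}=\mathcal{A}^!$ of $\mathcal{A}=k[\mathbf{D}(W)]$ is $\mathcal{P}=\mathcal{T}(k^{\{x_t:t\in T\}})/\langle R^\perp\rangle$, where $x_t$ is the basis dual to $(\mathbf{t})_{t\in T}$ and $R^\perp$ is spanned by: (1) $x_t\otimes x_t$ for $t\in T$; (2) $x_t\otimes x_u$ for $t,u\in T$ with $tu\not\le_T c$; (3) $x_{u_1}\otimes x_{u_m}+x_{u_m}\otimes x_{u_{m-1}}+\cdots+x_{u_2}\otimes x_{u_1}$ for each $w\in NC_2$, where $\{t\in T: t\le_T w\}=\{u_1\prec\dots\prec u_m\}$.
   Context: $T$ is the set of reflections of $W$; $t^u=u^{ -1}tu$; $\ell_T$ is reflection length, $w\le_T z$ iff $\ell_T(w)+\ell_T(w^{ -1}z)=\ell_T(z)$; $NC=[e,c]$ in this order and $NC_2$ its elements of length 2. $\mathbf{D}(W)$ has generators $\mathbf{t}$ ($t\in T$) and relations $\mathbf{t}\mathbf{u}=\mathbf{u}\mathbf{t}^{\mathbf{u}}$ whenever $tu\le_T c$, so $\mathcal{A}=\mathcal{T}(k^{\mathbf{T}})/\langle R\rangle$ with $R$ spanned by $\mathbf{t}\otimes\mathbf{u}-\mathbf{u}\otimes\mathbf{t}^{\mathbf{u}}$, and $\mathcal{A}^!=\mathcal{T}((k^{\mathbf{T}})^*)/\langle R^\perp\rangle$. A reflection ordering is a total order on $T$ such that for each rank 2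 parabolic subgroup, with reflections $u_1,\dots,u_m$ indexed so that $u_{i+1}u_i=u_iu_{i-1}$ (indices mod $m$) and $u_1,u_m$ simple, they appear in the order $u_1,\dots,u_m$ or its reverse; it is $c$-compatible if for each $w\in NC_2$ with $\{t\le_T w\}=\{u_1\prec\dots\prec u_m\}$, $w=u_iu_{i-1}$ for all $i$ ($u_0=u_m$). -}

module Defs where

open import Level using (0ℓ)
open import Data.Nat using (ℕ; zero; suc; _+_; _≤_; _<_; _%_)
open import Data.Nat.DivMod using (m%n<n)
open import Data.Fin using (Fin; toℕ; fromℕ<; _≟_)
import Data.Fin as Fin
open import Data.Fin.Permutation using (Permutation′; _⟨$⟩ʳ_)
open import Data.List using (List; []; _∷_)
open import Data.List.Relation.Unary.All using (All)
open import Data.List.Relation.Unary.Any using (Any)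
open import Data.Product using (Σ; ∃; ∃-syntax; _×_; _,_; proj₁; proj₂)
open import Data.Sum using (_⊎_)
open import Data.Bool using (if_then_else_)
open import Relation.Nullary using (¬_; does)
open import Relation.Binary.PropositionalEquality using (_≡_; _≢_)
open import Relation.Binary.Definitions using (Decidable)
open import Function.Bundles using (_⇔_)
open import Algebra.Bundles using (Group; CommutativeRing)

module _ (G : Group 0ℓ 0ℓ) where
  open Group G
  gpow : Carrier → ℕ → Carrier
  gpow x zero    = ε
  gpow x (suc k) = x ∙ gpow x k

  gprod : (k : ℕ) → (Fin k → Carrier) → Carrier
  gprod zero    g = ε
  gprod (suc k) g = g Fin.zero ∙ gprod k (λ i → g (Fin.suc i))

wrap : (m : ℕ) → ℕ → Fin (suc m)
wrap m k = fromℕ< (m%n<n k (suc m))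

IsField : CommutativeRing 0ℓ 0ℓ → Set
IsField K = (¬ (1# ≈ 0#)) × (∀ x → ¬ (x ≈ 0#) → ∃[ y ] (x * y ≈ 1#))
  where open CommutativeRing K

record CoxeterSystem : Set₁ where
  field
    W     : Group 0ℓ 0ℓ
    rank  : ℕ
    m     : Fin rank → Fin rank → ℕ
    s     : Fin rank → Group.Carrier W
  open Group W
  field
    m-diag : ∀ i → m i i ≡ 1
    m-sym  : ∀ i j → m i j ≡ m j i
    m-off  : ∀ i j → i ≢ j → 2 ≤ m i j
    rel    : ∀ i j → gpow W (s i ∙ s j) (m i j) ≈ ε
    gen    : ∀ w → ∃[ k ] Σ (Fin k → Fin rank) λ g → w ≈ gprod W k (λ l → s (g l))
    univ   : (H : Group 0ℓ 0ℓ) (f : Fin rank → Group.Carrier H) →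
             (∀ i j → Group._≈_ H (gpow H (Group._∙_ H (f i) (f j)) (m i j)) (Group.ε H)) →
             Σ (Carrier → Group.Carrier H) λ φ →
               (∀ x y → x ≈ y → Group._≈_ H (φ x) (φ y)) ×
               (∀ x y → Group._≈_ H (φ (x ∙ y)) (Group._∙_ H (φ x) (φ y))) ×
               (∀ i → Group._≈_ H (φ (s i)) (f i))

IsFiniteCoxeter : CoxeterSystem → Set
IsFiniteCoxeter C =
  (∃[ elems ] (∀ w → Any (λ v → w ≈ v) elems)) × Decidable _≈_
  where open CoxeterSystem C; open Group W

module Cox (C : CoxeterSystem) where
  open CoxeterSystem C public
  open Group W public using (Carrier; _≈_; _∙_; ε; _⁻¹)

  IsRefl : Carrier → Set
  IsRefl t = ∃[ w ] ∃[ i ] (t ≈ (w ∙ s i) ∙ (w ⁻¹))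

  ProdRefl : ℕ → Carrier → Set
  ProdRefl k w = Σ (Fin k → Carrier) λ g → (∀ l → IsRefl (g l)) × (w ≈ gprod W k g)

  ℓT : Carrier → ℕ → Set
  ℓT w k = ProdRefl k w × (∀ j → ProdRefl j w → k ≤ j)

  _≤T_ : Carrier → Carrier → Set
  w ≤T z = ∃[ a ] ∃[ b ] (ℓT w a × ℓT ((w ⁻¹) ∙ z) b × ℓT z (a + b))

  ProdSimple : ℕ → Carrier → Set
  ProdSimple k w = Σ (Fin k → Fin rank) λ g → w ≈ gprod W k (λ l → s (g l))

  ℓS : Carrier → ℕ → Set
  ℓS w k = ProdSimple k w × (∀ j → ProdSimple j w → k ≤ j)

  ℓS< : Carrier → Carrier → Set
  ℓS< x y = ∃[ a ] ∃[ b ] (ℓS x a × ℓS y b × a < b)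

  IsStandardCoxeterElement : Carrier → Set
  IsStandardCoxeterElement c =
    Σ (Permutation′ rank) λ σ → c ≈ gprod W rank (λ l → s (σ ⟨$⟩ʳ l))

  NC₂ : Carrier → Carrier → Set
  NC₂ c w = (w ≤T c) × ℓT w 2

  InPar : Carrier → Fin rank → Fin rank → Carrier → Set
  InPar w i j x =
    ∃[ k ] Σ (Fin k → Fin rank) λ g → (∀ l → (g l ≡ i) ⊎ (g l ≡ j)) ×
      (x ≈ (w ∙ gprod W k (λ l → s (g l))) ∙ (w ⁻¹))

  -- t is a canonical simple reflection of the reflection subgroup P
  -- (Dyer: N(t) ∩ P = {t}, N(t) = {t' ∈ T : ℓ_S(t't) < ℓ_S(t)})
  CanonSimple : (Carrier → Set) → Carrier → Set
  CanonSimple P t = ∀ t' → IsRefl t' → P t' → ℓS< (t' ∙ t) t → t' ≈ t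

  -- A total order on T is given as an enumeration  ref : Fin N → T,
  -- bijective onto T; the order is  ref a ≺ ref b  iff  a < b.
  module Ordering (N : ℕ) (ref : Fin N → Carrier) where

    IsEnumeration : Set
    IsEnumeration =
      (∀ a → IsRefl (ref a)) × (∀ a b → ref a ≈ ref b → a ≡ b) ×
      (∀ t → IsRefl t → ∃[ a ] (t ≈ ref a))

    OrderedEnum : (Carrier → Set) → (m : ℕ) → (Fin (suc m) → Fin N) → Set
    OrderedEnum P m us =
      (∀ a b → a Fin.< b → us a Fin.< us b) × (∀ j → P (ref j) ⇔ (∃[ a ] (us a ≡ j)))

    IsReflectionOrdering : Set
    IsReflectionOrdering =
      IsEnumeration ×
      (∀ w i j → i ≢ j → ∀ m us → OrderedEnum (InPar w i j) m us →
        (∀ (k : Fin (suc m)) →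
           (ref (us (wrap m (suc (toℕ k)))) ∙ ref (us (wrap m (toℕ k))))
             ≈ (ref (us (wrap m (toℕ k))) ∙ ref (us (wrap m (toℕ k + m))))) ×
        CanonSimple (InPar w i j) (ref (us Fin.zero)) ×
        CanonSimple (InPar w i j) (ref (us (Fin.fromℕ m))))

    IsCCompatible : Carrier → Set
    IsCCompatible c =
      ∀ w → NC₂ c w → ∀ m us → OrderedEnum (λ t → t ≤T w) m us →
        ∀ (k : Fin (suc m)) →
          w ≈ (ref (us (wrap m (toℕ k))) ∙ ref (us (wrap m (toℕ k + m))))

    -- Linear algebra over a field K.  (k^T)^{⊗2} and its dual are both
    -- identified with coefficient arrays Fin N → Fin N → K in the bases
    -- t⊗u resp. x_t⊗x_u;  the pairing is ⟨f , r⟩ = Σ_{a,b} f a b *k r a b.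
    module Lin (K : CommutativeRing 0ℓ 0ℓ) where
      open CommutativeRing K renaming (Carrier to k; _≈_ to _≈k_; _+_ to _+k_; _*_ to _*k_; _-_ to _-k_)

      Tensor : Set
      Tensor = Fin N → Fin N → k

      _≐_ : Tensor → Tensor → Set
      f ≐ g = ∀ a b → f a b ≈k g a b

      sumK : (n : ℕ) → (Fin n → k) → k
      sumK zero    g = 0#
      sumK (suc n) g = g Fin.zero +k sumK n (λ i → g (Fin.suc i))

      e : Fin N → Fin N → Tensor
      e a b a' b' = if does (a ≟ a') then (if does (b ≟ b') then 1# else 0#) else 0#

      pairing : Tensor → Tensor → k
      pairing f r = sumK N (λ a → sumK N (λ b → f a b *k r a b))

      lincomb : List (k × Tensor) → Tensor
      lincomb []             a b = 0#
      lincomb ((λ' , g) ∷ gs) a b = (λ' *k g a b) +k lincomb gs a b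

      Span : (Tensor → Set) → Tensor → Set
      Span G f = ∃[ gs ] (All (λ p → G (proj₂ p)) gs × (f ≐ lincomb gs))

      module WithC (c : Carrier) where
        -- spanning set of R:  t⊗u − u⊗t^u  for tu ≤_T c  (t^u = u⁻¹ t u)
        RGen : Tensor → Set
        RGen r = ∃[ a ] ∃[ b ] ∃[ j ]
          (((ref a ∙ ref b) ≤T c) × (ref j ≈ ((ref b ⁻¹) ∙ ref a) ∙ ref b) ×
           (r ≐ (λ a' b' → e a b a' b' -k e b j a' b')))

        InRperp : Tensor → Set
        InRperp f = ∀ r → Span RGen r → pairing f r ≈k 0#

        -- x_{u_1}⊗x_{u_m} + x_{u_m}⊗x_{u_{m-1}} + ... + x_{u_2}⊗x_{u_1}
        -- (0-based: v_i = us i, terms x_{v_i} ⊗ x_{v_{i-1}}, v_{-1} = v_m)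
        cycElem : (m : ℕ) → (Fin (suc m) → Fin N) → Tensor
        cycElem m us a' b' =
          sumK (suc m) (λ i → e (us (wrap m (toℕ i))) (us (wrap m (toℕ i + m))) a' b')

        DualGen : Tensor → Set
        DualGen f =
          (∃[ a ] (f ≐ e a a)) ⊎
          (∃[ a ] ∃[ b ] ((¬ ((ref a ∙ ref b) ≤T c)) × (f ≐ e a b))) ⊎
          (∃[ w ] ∃[ m ] Σ (Fin (suc m) → Fin N) λ us →
             NC₂ c w × OrderedEnum (λ t → t ≤T w) m us × (f ≐ cycElem m us))

-- A tensor lies in R^⊥ exactly when it is invariant under the Hurwitz moves (t, u) ↦ (u, tᵘ)
-- with tu ≤_T c, and each of the tensors (1)–(3) is invariant.  Conversely, the pairs (t, u)
-- with t ≠ u and tu ≤_T c are grouped by their product w ∈ NC₂, and c-compatibility says that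
-- the factorisations of w into two reflections are exactly the pairs (u_i, u_{i-1}): a single
-- orbit of Hurwitz moves.  An invariant f is thus constant on each group, and f is the
-- combination of (1)–(3) with coefficients read off f, the group of w contributing
-- f(u₁, u_m) times the cyclic sum (3).

module Submission where

open import Defs
open import Level using (0ℓ)
open import Data.Nat using (ℕ)
open import Data.Fin using (Fin)
open import Function.Bundles using (_⇔_)
open import Algebra.Bundles using (CommutativeRing)

open import Algebra.Bundles using (Group)
import Algebra.Properties.Group as GroupProperties
open import Data.Bool using (Bool; true; false; _xor_)
open import Data.Bool.Properties using (xor-∧-commutativeRing; xor-same)
open import Data.Empty using (⊥-elim)
open import Data.Fin as Fin using (zero; suc; toℕ; _<_)
import Data.Fin.Properties as Finₚ
open import Data.List using ([]; _∷_; _++_)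
open import Data.List.Relation.Unary.All using (All; []; _∷_)
import Data.List.Relation.Unary.All.Properties as Allₚ
open import Data.Nat as ℕ using (zero; suc; _+_; _≤_; _%_)
open import Data.Nat.DivMod using (m<n⇒m%n≡m; [m+n]%n≡m%n)
import Data.Nat.Properties as ℕₚ
open import Data.Product using (Σ; ∃; _×_; _,_; proj₁; proj₂)
open import Data.Sum using (_⊎_; inj₁; inj₂)
import Data.Vec.Functional as Vector
open import Function using (_∘_)
open import Function.Bundles using (mk⇔; Equivalence)
open import Relation.Binary.PropositionalEquality as ≡ using (_≡_; _≢_)
open import Relation.Binary.Definitions using (tri<; tri≈; tri>)
import Relation.Binary.Reasoning.Setoid as SetoidReasoning
open import Relation.Nullary using (¬_; Dec; yes; no)
open import Relation.Nullary.Decidable using (map′; ¬?; _×-dec_; _→-dec_)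

module _ (G : Group 0ℓ 0ℓ) where
  open Group G

  gpow-ε : ∀ n → gpow G ε n ≈ ε
  gpow-ε zero    = refl
  gpow-ε (suc n) = trans (identityˡ _) (gpow-ε n)

  gprod-cong : ∀ k {g h : Fin k → Carrier} → (∀ l → g l ≈ h l) → gprod G k g ≈ gprod G k h
  gprod-cong zero    g≈h = refl
  gprod-cong (suc k) g≈h = ∙-cong (g≈h zero) (gprod-cong k (λ l → g≈h (suc l)))

parityGroup : Group 0ℓ 0ℓ
parityGroup = CommutativeRing.+-group xor-∧-commutativeRing

module _ {Q : ℕ → Set} (Q? : ∀ n → Dec (Q n)) where

  minimal : ∀ v → (∃ λ n → n ℕ.< v × Q n) → ∃ λ k → Q k × (∀ j → Q j → k ≤ j)
  minimal (suc v) ∃Q with ℕₚ.anyUpTo? Q? v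
  ... | yes ∃Q< = minimal v ∃Q<
  ... | no ∄Q<  = n , Qn , λ j Qj →
    ℕₚ.≤-trans (ℕₚ.m<1+n⇒m≤n n<1+v) (ℕₚ.≮⇒≥ (λ j<v → ∄Q< (j , j<v , Qj)))
    where
    n = proj₁ ∃Q
    n<1+v = proj₁ (proj₂ ∃Q)
    Qn = proj₂ (proj₂ ∃Q)

wrap-toℕ : ∀ m (k : Fin (suc m)) → wrap m (toℕ k) ≡ k
wrap-toℕ m k = Finₚ.toℕ-injective (≡.trans (Finₚ.toℕ-fromℕ< _) (m<n⇒m%n≡m (Finₚ.toℕ<n k)))

toℕ-wrap-pred : ∀ m (k : Fin (suc m)) {n} → toℕ k ≡ suc n → toℕ (wrap m (toℕ k + m)) ≡ n
toℕ-wrap-pred m k {n} k≡1+n = begin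
  toℕ (wrap m (toℕ k + m)) ≡⟨ Finₚ.toℕ-fromℕ< _ ⟩
  (toℕ k + m) % suc m      ≡⟨ ≡.cong (λ i → (i + m) % suc m) k≡1+n ⟩
  (suc n + m) % suc m      ≡⟨ ≡.cong (_% suc m) (ℕₚ.+-suc n m) ⟨
  (n + suc m) % suc m      ≡⟨ [m+n]%n≡m%n n (suc m) ⟩
  n % suc m                ≡⟨ m<n⇒m%n≡m n<1+m ⟩
  n                        ∎
  where
  open ≡.≡-Reasoning
  n<1+m : n ℕ.< suc m
  n<1+m = ℕₚ.<-trans (ℕₚ.n<1+n n) (≡.subst (ℕ._< suc m) k≡1+n (Finₚ.toℕ<n k))

enumerate : ∀ {n} {P : Fin n → Set} → (∀ j → Dec (P j)) →
  Σ ℕ λ m → Σ (Fin m → Fin n) λ us →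
    (∀ a b → a < b → us a < us b) × (∀ j → P j ⇔ ∃ λ a → us a ≡ j)
enumerate {zero} P? = 0 , (λ ()) , (λ ()) , (λ ())
enumerate {suc n} {P} P? with enumerate (λ j → P? (suc j)) | P? zero
... | m , us , mono , ch | yes P0 = suc m , us′ , mono′ , ch′
  where
  us′ : Fin (suc m) → Fin (suc n)
  us′ = zero Vector.∷ (suc ∘ us)
  mono′ : ∀ a b → a < b → us′ a < us′ b
  mono′ zero    (suc b) _           = ℕ.s≤s ℕ.z≤n
  mono′ (suc a) (suc b) (ℕ.s≤s a<b) = ℕ.s≤s (mono a b a<b)
  ch′ : ∀ j → P j ⇔ ∃ λ a → us′ a ≡ j
  ch′ zero    = mk⇔ (λ _ → zero , ≡.refl) (λ _ → P0)
  ch′ (suc j) = mk⇔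
    (λ Pj → let (a , us≡) = Equivalence.to (ch j) Pj in suc a , ≡.cong suc us≡)
    (λ { (zero , ()) ; (suc a , us≡) → Equivalence.from (ch j) (a , Finₚ.suc-injective us≡) })
... | m , us , mono , ch | no ¬P0 = m , suc ∘ us , (λ a b a<b → ℕ.s≤s (mono a b a<b)) , ch′
  where
  ch′ : ∀ j → P j ⇔ ∃ λ a → suc (us a) ≡ j
  ch′ zero    = mk⇔ (λ P0 → ⊥-elim (¬P0 P0)) (λ ())
  ch′ (suc j) = mk⇔
    (λ Pj → let (a , us≡) = Equivalence.to (ch j) Pj in a , ≡.cong suc us≡)
    (λ (a , us≡) → Equivalence.from (ch j) (a , Finₚ.suc-injective us≡))

module ReflectionFacts (C : CoxeterSystem) where
  open Cox C
  open Group W using (setoid; refl; sym; trans; assoc; ∙-cong; ∙-congˡ; ∙-congʳ; ⁻¹-cong;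
                      identityˡ; identityʳ; inverseʳ)
  open GroupProperties W

  simple-selfInverse : ∀ i → s i ⁻¹ ≈ s i
  simple-selfInverse i = sym (inverseˡ-unique (s i) (s i) sᵢ²≈ε)
    where
    sᵢ²≈ε : s i ∙ s i ≈ ε
    sᵢ²≈ε = trans (sym (identityʳ _)) (≡.subst (λ n → gpow W (s i ∙ s i) n ≈ ε) (m-diag i) (rel i i))

  simple-IsRefl : ∀ i → IsRefl (s i)
  simple-IsRefl i = ε , i , sym (trans (∙-cong (identityˡ (s i)) ε⁻¹≈ε) (identityʳ (s i)))

  IsRefl-selfInverse : ∀ {t} → IsRefl t → t ⁻¹ ≈ t
  IsRefl-selfInverse {t} (w , i , t≈) = begin
    t ⁻¹                   ≈⟨ ⁻¹-cong t≈ ⟩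
    ((w ∙ s i) ∙ w ⁻¹) ⁻¹  ≈⟨ ⁻¹-anti-homo-∙ (w ∙ s i) (w ⁻¹) ⟩
    w ⁻¹ ⁻¹ ∙ (w ∙ s i) ⁻¹ ≈⟨ ∙-cong (⁻¹-involutive w) (⁻¹-anti-homo-∙ w (s i)) ⟩
    w ∙ (s i ⁻¹ ∙ w ⁻¹)    ≈⟨ ∙-congˡ (∙-congʳ (simple-selfInverse i)) ⟩
    w ∙ (s i ∙ w ⁻¹)       ≈⟨ assoc w (s i) (w ⁻¹) ⟨
    (w ∙ s i) ∙ w ⁻¹       ≈⟨ t≈ ⟨
    t                      ∎
    where open SetoidReasoning setoid

  IsRefl-involution : ∀ {t} → IsRefl t → t ∙ t ≈ ε
  IsRefl-involution {t} r = trans (∙-congˡ (sym (IsRefl-selfInverse r))) (inverseʳ t)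

  ∙≈ε⇒≈ : ∀ {x t} → IsRefl t → x ∙ t ≈ ε → x ≈ t
  ∙≈ε⇒≈ {x} {t} r xt≈ε = trans (inverseˡ-unique x t xt≈ε) (IsRefl-selfInverse r)

  private
    parityHom = univ parityGroup (λ _ → true) (λ i j → gpow-ε parityGroup (m i j))

  parity : Carrier → Bool
  parity = proj₁ parityHom

  parity-cong : ∀ {x y} → x ≈ y → parity x ≡ parity y
  parity-cong = proj₁ (proj₂ parityHom) _ _

  parity-∙ : ∀ x y → parity (x ∙ y) ≡ parity x xor parity y
  parity-∙ = proj₁ (proj₂ (proj₂ parityHom))

  parity-s : ∀ i → parity (s i) ≡ true
  parity-s = proj₂ (proj₂ (proj₂ parityHom))

  parity-ε : parity ε ≡ false
  parity-ε = ≡.trans (parity-cong (sym (identityʳ ε))) (≡.trans (parity-∙ ε ε) (xor-same (parity ε)))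

  parity-⁻¹ : ∀ x → parity (x ⁻¹) ≡ parity x
  parity-⁻¹ x = ≡.sym (GroupProperties.x∙y⁻¹≈ε⇒x≈y parityGroup (parity x) (parity (x ⁻¹))
    (≡.trans (≡.sym (parity-∙ x (x ⁻¹))) (≡.trans (parity-cong (inverseʳ x)) parity-ε)))

  parity-IsRefl : ∀ {t} → IsRefl t → parity t ≡ true
  parity-IsRefl {t} (w , i , t≈) = begin
    parity t                                         ≡⟨ parity-cong t≈ ⟩
    parity ((w ∙ s i) ∙ w ⁻¹)                        ≡⟨ parity-∙ (w ∙ s i) (w ⁻¹) ⟩
    parity (w ∙ s i) xor parity (w ⁻¹)               ≡⟨ ≡.cong₂ _xor_ (parity-∙ w (s i)) (parity-⁻¹ w) ⟩
    (parity w xor parity (s i)) xor parity w         ≡⟨ ≡.cong (λ b → (parity w xor b) xor parity w) (parity-s i) ⟩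
    (parity w xor true) xor parity w                 ≡⟨ conjugate-xor (parity w) ⟩
    true                                             ∎
    where
    open ≡.≡-Reasoning
    conjugate-xor : ∀ b → (b xor true) xor b ≡ true
    conjugate-xor true  = ≡.refl
    conjugate-xor false = ≡.refl

  reflection≉ε : ∀ {t} → IsRefl t → ¬ t ≈ ε
  reflection≉ε r t≈ε with ≡.trans (≡.sym (parity-IsRefl r)) (≡.trans (parity-cong t≈ε) parity-ε)
  ... | ()

  reflection∙reflection≉reflection : ∀ {a b t} → IsRefl a → IsRefl b → IsRefl t → ¬ a ∙ b ≈ t
  reflection∙reflection≉reflection {a} {b} ra rb rt ab≈t
    with ≡.trans (≡.sym (parity-IsRefl rt)) (≡.trans (parity-cong (sym ab≈t))
           (≡.trans (parity-∙ a b) (≡.cong₂ _xor_ (parity-IsRefl ra) (parity-IsRefl rb))))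
  ... | ()

module ReflectionLength (C : CoxeterSystem) (fin : IsFiniteCoxeter C)
                        (N : ℕ) (ref : Fin N → Cox.Carrier C)
                        (isEnum : Cox.Ordering.IsEnumeration C N ref) where
  open Cox C
  open Group W using (refl; sym; trans; ∙-cong; ∙-congˡ; ∙-congʳ; ⁻¹-cong; identityʳ)
  open GroupProperties W using (y≈x\\z; \\-leftDividesˡ; \\-leftDividesʳ)
  open ReflectionFacts C

  _≈?_ : ∀ x y → Dec (x ≈ y)
  _≈?_ = proj₂ fin

  ref-IsRefl : ∀ a → IsRefl (ref a)
  ref-IsRefl = proj₁ isEnum

  ref-injective : ∀ {a b} → ref a ≈ ref b → a ≡ b
  ref-injective = proj₁ (proj₂ isEnum) _ _

  ref-surjective : ∀ {t} → IsRefl t → ∃ λ a → t ≈ ref a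
  ref-surjective = proj₂ (proj₂ isEnum) _

  ProdIndexed : ℕ → Carrier → Set
  ProdIndexed k x = Σ (Fin k → Fin N) λ g → x ≈ gprod W k (λ l → ref (g l))

  ProdIndexed? : ∀ k x → Dec (ProdIndexed k x)
  ProdIndexed? zero    x = map′ ((λ ()) ,_) proj₂ (x ≈? ε)
  ProdIndexed? (suc k) x = map′ cons uncons (Finₚ.any? λ a → ProdIndexed? k (ref a ⁻¹ ∙ x))
    where
    cons : (∃ λ a → ProdIndexed k (ref a ⁻¹ ∙ x)) → ProdIndexed (suc k) x
    cons (a , g , x′≈) = a Vector.∷ g , trans (sym (\\-leftDividesˡ (ref a) x)) (∙-congˡ x′≈)
    uncons : ProdIndexed (suc k) x → ∃ λ a → ProdIndexed k (ref a ⁻¹ ∙ x)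
    uncons (g , x≈) = g zero , g ∘ suc , trans (∙-congˡ x≈) (\\-leftDividesʳ (ref (g zero)) _)

  ProdRefl? : ∀ k x → Dec (ProdRefl k x)
  ProdRefl? k x = map′ fromIndexed toIndexed (ProdIndexed? k x)
    where
    fromIndexed : ProdIndexed k x → ProdRefl k x
    fromIndexed (g , x≈) = ref ∘ g , ref-IsRefl ∘ g , x≈
    toIndexed : ProdRefl k x → ProdIndexed k x
    toIndexed (g , r , x≈) = (λ l → proj₁ (ref-surjective (r l))) ,
      trans x≈ (gprod-cong W k (λ l → proj₂ (ref-surjective (r l))))

  ℓT-exists : ∀ x → ∃ (ℓT x)
  ℓT-exists x = minimal (λ n → ProdRefl? n x) (suc k) (k , ℕₚ.n<1+n k , simpleWord)
    where
    k = proj₁ (gen x)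
    simpleWord : ProdRefl k x
    simpleWord = s ∘ proj₁ (proj₂ (gen x)) , simple-IsRefl ∘ proj₁ (proj₂ (gen x)) , proj₂ (proj₂ (gen x))

  ℓT-unique : ∀ {x a b} → ℓT x a → ℓT x b → a ≡ b
  ℓT-unique (pa , minA) (pb , minB) = ℕₚ.≤-antisym (minA _ pb) (minB _ pa)

  ProdRefl-cong : ∀ {k x y} → x ≈ y → ProdRefl k x → ProdRefl k y
  ProdRefl-cong x≈y (g , r , x≈) = g , r , trans (sym x≈y) x≈

  ℓT-cong : ∀ {x y k} → x ≈ y → ℓT x k → ℓT y k
  ℓT-cong x≈y (p , min) = ProdRefl-cong x≈y p , λ j q → min j (ProdRefl-cong (sym x≈y) q)

  ≤T? : ∀ w z → Dec (w ≤T z)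
  ≤T? w z with ℓT-exists w | ℓT-exists (w ⁻¹ ∙ z) | ℓT-exists z
  ... | a , ℓw | b , ℓw⁻¹z | l , ℓz = map′ lengthsAdd addLengths (a + b ℕₚ.≟ l)
    where
    lengthsAdd : a + b ≡ l → w ≤T z
    lengthsAdd a+b≡l = a , b , ℓw , ℓw⁻¹z , ≡.subst (ℓT z) (≡.sym a+b≡l) ℓz
    addLengths : w ≤T z → a + b ≡ l
    addLengths (_ , _ , ℓw′ , ℓw⁻¹z′ , ℓz′) =
      ≡.trans (≡.cong₂ _+_ (ℓT-unique ℓw ℓw′) (ℓT-unique ℓw⁻¹z ℓw⁻¹z′)) (ℓT-unique ℓz′ ℓz)

  ≤T-congˡ : ∀ {w w′ z} → w ≈ w′ → w ≤T z → w′ ≤T z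
  ≤T-congˡ w≈w′ (a , b , ℓw , ℓw⁻¹z , ℓz) =
    a , b , ℓT-cong w≈w′ ℓw , ℓT-cong (∙-congʳ (⁻¹-cong w≈w′)) ℓw⁻¹z , ℓz

  ≤T-congʳ : ∀ {w z z′} → z ≈ z′ → w ≤T z → w ≤T z′
  ≤T-congʳ z≈z′ (a , b , ℓw , ℓw⁻¹z , ℓz) =
    a , b , ℓw , ℓT-cong (∙-congˡ z≈z′) ℓw⁻¹z , ℓT-cong z≈z′ ℓz

  ℓT-reflection : ∀ {t} → IsRefl t → ℓT t 1
  ℓT-reflection {t} r = ((λ _ → t) , (λ _ → r) , sym (identityʳ t)) , minimality
    where
    minimality : ∀ j → ProdRefl j t → 1 ≤ j
    minimality zero    (_ , _ , t≈ε) = ⊥-elim (reflection≉ε r t≈ε)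
    minimality (suc j) _             = ℕ.s≤s ℕ.z≤n

  ℓT-reflection∙reflection : ∀ {a b} → IsRefl a → IsRefl b → ¬ a ∙ b ≈ ε → ℓT (a ∙ b) 2
  ℓT-reflection∙reflection {a} {b} ra rb ab≉ε =
    (a Vector.∷ (λ _ → b) , (λ { zero → ra ; (suc _) → rb }) , ∙-congˡ (sym (identityʳ b))) , minimality
    where
    minimality : ∀ j → ProdRefl j (a ∙ b) → 2 ≤ j
    minimality zero          (_ , _ , ab≈ε)  = ⊥-elim (ab≉ε ab≈ε)
    minimality (suc zero)    (g , rg , ab≈g) =
      ⊥-elim (reflection∙reflection≉reflection ra rb (rg zero) (trans ab≈g (identityʳ _)))
    minimality (suc (suc j)) _               = ℕ.s≤s (ℕ.s≤s ℕ.z≤n)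

  reflection≤T : ∀ {x y w} → IsRefl x → IsRefl y → ℓT w 2 → x ∙ y ≈ w → x ≤T w
  reflection≤T {x} {y} {w} rx ry ℓw xy≈w =
    1 , 1 , ℓT-reflection rx , ℓT-cong (y≈x\\z x y w xy≈w) (ℓT-reflection ry) , ℓw

module TensorAlgebra (C : CoxeterSystem) (N : ℕ) (ref : Fin N → Cox.Carrier C)
                     (K : CommutativeRing 0ℓ 0ℓ) where
  open Cox.Ordering.Lin C N ref K public
  open CommutativeRing K
    using (0#; 1#; -_; setoid; refl; sym; trans; +-cong; +-congˡ; +-congʳ; *-congˡ; +-identityˡ; +-identityʳ;
           *-identityˡ; *-identityʳ; +-assoc; zeroʳ; distribˡ; *-comm; ring; +-group; +-abelianGroup;
           +-commutativeSemigroup; *-commutativeSemigroup)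
    renaming (Carrier to k; _≈_ to _≈k_; _+_ to _+k_; _*_ to _*k_; _-_ to _-k_)
  open GroupProperties +-group using (ε⁻¹≈ε)
  open import Algebra.Properties.Ring ring using (x[y-z]≈xy-xz)
  import Algebra.Properties.AbelianGroup +-abelianGroup as +-AbelianGroup
  open import Algebra.Properties.CommutativeSemigroup +-commutativeSemigroup using (interchange)
  open import Algebra.Properties.CommutativeSemigroup *-commutativeSemigroup
    using () renaming (x∙yz≈y∙xz to x*yz≈y*xz)

  sumK-cong : ∀ n {g h : Fin n → k} → (∀ i → g i ≈k h i) → sumK n g ≈k sumK n h
  sumK-cong zero    g≈h = refl
  sumK-cong (suc n) g≈h = +-cong (g≈h zero) (sumK-cong n (g≈h ∘ suc))

  sumK-zero : ∀ n {g : Fin n → k} → (∀ i → g i ≈k 0#) → sumK n g ≈k 0#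
  sumK-zero zero    g≈0 = refl
  sumK-zero (suc n) g≈0 = trans (+-cong (g≈0 zero) (sumK-zero n (g≈0 ∘ suc))) (+-identityˡ 0#)

  sumK-δ : ∀ n {g : Fin n → k} i₀ → (∀ i → i ≢ i₀ → g i ≈k 0#) → sumK n g ≈k g i₀
  sumK-δ (suc n) zero     g≈0 = trans (+-congˡ (sumK-zero n (λ i → g≈0 (suc i) λ ()))) (+-identityʳ _)
  sumK-δ (suc n) (suc i₀) g≈0 =
    trans (+-cong (g≈0 zero λ ()) (sumK-δ n i₀ λ i i≢i₀ → g≈0 (suc i) (i≢i₀ ∘ Finₚ.suc-injective)))
          (+-identityˡ _)

  sumK-+ : ∀ n {g h : Fin n → k} → sumK n (λ i → g i +k h i) ≈k sumK n g +k sumK n h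
  sumK-+ zero    = sym (+-identityˡ 0#)
  sumK-+ (suc n) = trans (+-congˡ (sumK-+ n)) (interchange _ _ _ _)

  sumK-* : ∀ n x {g : Fin n → k} → sumK n (λ i → x *k g i) ≈k x *k sumK n g
  sumK-* zero    x = sym (zeroʳ x)
  sumK-* (suc n) x = trans (+-congˡ (sumK-* n x)) (sym (distribˡ x _ _))

  sumK-neg : ∀ n {g : Fin n → k} → sumK n (λ i → - g i) ≈k - sumK n g
  sumK-neg zero    = sym ε⁻¹≈ε
  sumK-neg (suc n) = trans (+-congˡ (sumK-neg n)) (+-AbelianGroup.⁻¹-∙-comm _ _)

  sum² : (Fin N → Fin N → k) → k
  sum² F = sumK N λ a → sumK N λ b → F a b

  sum²-cong : ∀ {F G} → (∀ a b → F a b ≈k G a b) → sum² F ≈k sum² G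
  sum²-cong F≈G = sumK-cong N λ a → sumK-cong N (F≈G a)

  sum²-zero : ∀ {F} → (∀ a b → F a b ≈k 0#) → sum² F ≈k 0#
  sum²-zero F≈0 = sumK-zero N λ a → sumK-zero N (F≈0 a)

  sum²-δ : ∀ {F} a₀ b₀ → (∀ a b → ¬ (a ≡ a₀ × b ≡ b₀) → F a b ≈k 0#) → sum² F ≈k F a₀ b₀
  sum²-δ a₀ b₀ F≈0 = trans (sumK-δ N a₀ λ a a≢a₀ → sumK-zero N λ b → F≈0 a b (a≢a₀ ∘ proj₁))
                           (sumK-δ N b₀ λ b b≢b₀ → F≈0 a₀ b (b≢b₀ ∘ proj₂))

  sum²-+ : ∀ F G → sum² (λ a b → F a b +k G a b) ≈k sum² F +k sum² G
  sum²-+ F G = trans (sumK-cong N λ a → sumK-+ N) (sumK-+ N)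

  sum²-* : ∀ x F → sum² (λ a b → x *k F a b) ≈k x *k sum² F
  sum²-* x F = trans (sumK-cong N λ a → sumK-* N x) (sumK-* N x)

  sum²-neg : ∀ F → sum² (λ a b → - F a b) ≈k - sum² F
  sum²-neg F = trans (sumK-cong N λ a → sumK-neg N) (sumK-neg N)

  e-diag : ∀ a b → e a b a b ≈k 1#
  e-diag a b with a Fin.≟ a | b Fin.≟ b
  ... | yes _   | yes _   = refl
  ... | no a≢a  | _       = ⊥-elim (a≢a ≡.refl)
  ... | yes _   | no b≢b  = ⊥-elim (b≢b ≡.refl)

  e-off : ∀ a b a′ b′ → ¬ (a ≡ a′ × b ≡ b′) → e a b a′ b′ ≈k 0#
  e-off a b a′ b′ ≢ with a Fin.≟ a′ | b Fin.≟ b′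
  ... | yes a≡a′ | yes b≡b′ = ⊥-elim (≢ (a≡a′ , b≡b′))
  ... | yes _    | no _     = refl
  ... | no _     | _        = refl

  e-resp : ∀ x y a b a′ b′ → (x ≡ a × y ≡ b) ⇔ (x ≡ a′ × y ≡ b′) → e x y a b ≈k e x y a′ b′
  e-resp x y a b a′ b′ match⇔ with (x Fin.≟ a) ×-dec (y Fin.≟ b)
  ... | yes (≡.refl , ≡.refl) with Equivalence.to match⇔ (≡.refl , ≡.refl)
  ...   | ≡.refl , ≡.refl = refl
  e-resp x y a b a′ b′ match⇔ | no ¬match =
    trans (e-off x y a b ¬match) (sym (e-off x y a′ b′ (¬match ∘ Equivalence.from match⇔)))

  pairing-comm : ∀ f r → pairing f r ≈k pairing r f
  pairing-comm f r = sum²-cong λ a b → *-comm (f a b) (r a b)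

  pairing-congʳ : ∀ f {r r′} → r ≐ r′ → pairing f r ≈k pairing f r′
  pairing-congʳ f r≐r′ = sum²-cong λ a b → *-congˡ (r≐r′ a b)

  pairing-e : ∀ f a b → pairing f (e a b) ≈k f a b
  pairing-e f a b = begin
    pairing f (e a b)    ≈⟨ sum²-δ a b off-diagonal ⟩
    f a b *k e a b a b   ≈⟨ *-congˡ (e-diag a b) ⟩
    f a b *k 1#          ≈⟨ *-identityʳ (f a b) ⟩
    f a b                ∎
    where
    open SetoidReasoning setoid
    off-diagonal : ∀ a′ b′ → ¬ (a′ ≡ a × b′ ≡ b) → f a′ b′ *k e a b a′ b′ ≈k 0#
    off-diagonal a′ b′ ≢ = trans (*-congˡ (e-off a b a′ b′ λ (p , q) → ≢ (≡.sym p , ≡.sym q))) (zeroʳ _)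

  pairing-linear : ∀ f x g h → pairing f (λ a b → x *k g a b +k h a b) ≈k x *k pairing f g +k pairing f h
  pairing-linear f x g h = begin
    pairing f (λ a b → x *k g a b +k h a b)
      ≈⟨ sum²-cong (λ a b → trans (distribˡ (f a b) _ _) (+-congʳ (x*yz≈y*xz (f a b) x (g a b)))) ⟩
    sum² (λ a b → x *k (f a b *k g a b) +k f a b *k h a b)
      ≈⟨ sum²-+ _ _ ⟩
    sum² (λ a b → x *k (f a b *k g a b)) +k pairing f h
      ≈⟨ +-congʳ (sum²-* x _) ⟩
    x *k pairing f g +k pairing f h ∎
    where open SetoidReasoning setoid

  pairing-− : ∀ f g h → pairing f (λ a b → g a b -k h a b) ≈k pairing f g -k pairing f h
  pairing-− f g h = begin
    pairing f (λ a b → g a b -k h a b)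
      ≈⟨ sum²-cong (λ a b → x[y-z]≈xy-xz (f a b) (g a b) (h a b)) ⟩
    sum² (λ a b → f a b *k g a b +k - (f a b *k h a b))
      ≈⟨ sum²-+ _ _ ⟩
    pairing f g +k sum² (λ a b → - (f a b *k h a b))
      ≈⟨ +-congˡ (sum²-neg _) ⟩
    pairing f g -k pairing f h ∎
    where open SetoidReasoning setoid

  lincomb-++ : ∀ gs hs a b → lincomb (gs ++ hs) a b ≈k lincomb gs a b +k lincomb hs a b
  lincomb-++ []             hs a b = sym (+-identityˡ _)
  lincomb-++ ((x , g) ∷ gs) hs a b = trans (+-congˡ (lincomb-++ gs hs a b)) (sym (+-assoc _ _ _))

  module _ {G : Tensor → Set} where

    Span-cong : ∀ {f g} → f ≐ g → Span G g → Span G f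
    Span-cong f≐g (gs , Ggs , g≐) = gs , Ggs , λ a b → trans (f≐g a b) (g≐ a b)

    Span-zero : Span G (λ _ _ → 0#)
    Span-zero = [] , [] , λ _ _ → refl

    Span-scaled : ∀ x {g} → G g → Span G (λ a b → x *k g a b)
    Span-scaled x {g} Gg = ((x , g) ∷ []) , (Gg ∷ []) , λ a b → sym (+-identityʳ _)

    Span-generator : ∀ {g} → G g → Span G g
    Span-generator Gg = Span-cong (λ a b → sym (*-identityˡ _)) (Span-scaled 1# Gg)

    Span-+ : ∀ {g h} → Span G g → Span G h → Span G (λ a b → g a b +k h a b)
    Span-+ (gs , Ggs , g≐) (hs , Ghs , h≐) =
      gs ++ hs , Allₚ.++⁺ Ggs Ghs , λ a b → trans (+-cong (g≐ a b) (h≐ a b)) (sym (lincomb-++ gs hs a b))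

    Span-sumK : ∀ n {h : Fin n → Tensor} → (∀ i → Span G (h i)) → Span G (λ a b → sumK n (λ i → h i a b))
    Span-sumK zero    _   = Span-zero
    Span-sumK (suc n) Ghᵢ = Span-+ (Ghᵢ zero) (Span-sumK n (Ghᵢ ∘ suc))

    pairing-Span : ∀ f → (∀ g → G g → pairing f g ≈k 0#) → ∀ {r} → Span G r → pairing f r ≈k 0#
    pairing-Span f f⊥G (rs , Grs , r≐) = trans (pairing-congʳ f r≐) (pairing-lincomb rs Grs)
      where
      pairing-lincomb : ∀ rs → All (G ∘ proj₂) rs → pairing f (lincomb rs) ≈k 0#
      pairing-lincomb []             []         = sum²-zero λ a b → zeroʳ (f a b)
      pairing-lincomb ((x , g) ∷ rs) (Gg ∷ Grs) = begin
        pairing f (lincomb ((x , g) ∷ rs))     ≈⟨ pairing-linear f x g (lincomb rs) ⟩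
        x *k pairing f g +k pairing f (lincomb rs) ≈⟨ +-cong (*-congˡ (f⊥G g Gg)) (pairing-lincomb rs Grs) ⟩
        x *k 0# +k 0#                          ≈⟨ +-identityʳ _ ⟩
        x *k 0#                                ≈⟨ zeroʳ x ⟩
        0#                                     ∎
        where open SetoidReasoning setoid

module Orthogonality (K : CommutativeRing 0ℓ 0ℓ) (C : CoxeterSystem) (c : Cox.Carrier C)
                     (N : ℕ) (ref : Fin N → Cox.Carrier C) where
  open Cox C
  open Group W using () renaming (sym to symW; trans to transW; assoc to assocW; ∙-congˡ to ∙-congˡW)
  open GroupProperties W using (y≈x\\z; \\-leftDividesˡ)
  open TensorAlgebra C N ref K
  open WithC c
  open CommutativeRing K using (0#; setoid; refl; sym; trans; +-cong; -‿cong; -‿inverseʳ; +-group)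
    renaming (_≈_ to _≈k_; _-_ to _-k_)
  open GroupProperties +-group using (x∙y⁻¹≈ε⇒x≈y)

  -- The condition tᵘ = u⁻¹tu of a Hurwitz move is stated in the equivalent form tu = utᵘ.
  HurwitzInvariant : Tensor → Set
  HurwitzInvariant f = ∀ a b j → (ref a ∙ ref b) ≤T c → ref a ∙ ref b ≈ ref b ∙ ref j → f a b ≈k f b j

  ∙-swap⇒conjugate : ∀ {x y z} → x ∙ y ≈ y ∙ z → z ≈ (y ⁻¹ ∙ x) ∙ y
  ∙-swap⇒conjugate {x} {y} {z} xy≈yz = transW (y≈x\\z y z (x ∙ y) (symW xy≈yz)) (symW (assocW (y ⁻¹) x y))

  conjugate⇒∙-swap : ∀ {x y z} → z ≈ (y ⁻¹ ∙ x) ∙ y → x ∙ y ≈ y ∙ z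
  conjugate⇒∙-swap {x} {y} {z} z≈ =
    symW (transW (∙-congˡW (transW z≈ (assocW (y ⁻¹) x y))) (\\-leftDividesˡ y (x ∙ y)))

  pairing-Hurwitz-move : ∀ f a b j → pairing f (λ a′ b′ → e a b a′ b′ -k e b j a′ b′) ≈k f a b -k f b j
  pairing-Hurwitz-move f a b j =
    trans (pairing-− f (e a b) (e b j)) (+-cong (pairing-e f a b) (-‿cong (pairing-e f b j)))

  InRperp⇒HurwitzInvariant : ∀ {f} → InRperp f → HurwitzInvariant f
  InRperp⇒HurwitzInvariant {f} f⊥R a b j ab≤c ab≈bj = x∙y⁻¹≈ε⇒x≈y (f a b) (f b j) (begin
    f a b -k f b j                                        ≈⟨ pairing-Hurwitz-move f a b j ⟨
    pairing f (λ a′ b′ → e a b a′ b′ -k e b j a′ b′)      ≈⟨ f⊥R _ (Span-generator move∈R) ⟩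
    0#                                                    ∎)
    where
    open SetoidReasoning setoid
    move∈R : RGen (λ a′ b′ → e a b a′ b′ -k e b j a′ b′)
    move∈R = a , b , j , ab≤c , ∙-swap⇒conjugate ab≈bj , λ _ _ → refl

  HurwitzInvariant⇒InRperp : ∀ {f} → HurwitzInvariant f → InRperp f
  HurwitzInvariant⇒InRperp {f} inv _ = pairing-Span f f⊥RGen
    where
    f⊥RGen : ∀ r → RGen r → pairing f r ≈k 0#
    f⊥RGen r (a , b , j , ab≤c , j≈ , r≐) = begin
      pairing f r                                      ≈⟨ pairing-congʳ f r≐ ⟩
      pairing f (λ a′ b′ → e a b a′ b′ -k e b j a′ b′) ≈⟨ pairing-Hurwitz-move f a b j ⟩
      f a b -k f b j                                   ≈⟨ +-cong (inv a b j ab≤c (conjugate⇒∙-swap j≈)) refl ⟩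
      f b j -k f b j                                   ≈⟨ -‿inverseʳ (f b j) ⟩
      0#                                               ∎
      where open SetoidReasoning setoid

  InRperp-Span : ∀ {G f} → (∀ g → G g → InRperp g) → Span G f → InRperp f
  InRperp-Span {f = f} G⊥R f∈ r r∈R =
    trans (pairing-comm f r) (pairing-Span r (λ g Gg → trans (pairing-comm r g) (G⊥R g Gg r r∈R)) f∈)

module Decomposition (K : CommutativeRing 0ℓ 0ℓ) (C : CoxeterSystem) (fin : IsFiniteCoxeter C)
                     (c : Cox.Carrier C) (N : ℕ) (ref : Fin N → Cox.Carrier C)
                     (isEnum : Cox.Ordering.IsEnumeration C N ref)
                     (compat : Cox.Ordering.IsCCompatible C N ref c) where
  open Cox C
  open Ordering N ref using (OrderedEnum)
  open Group W using () renaming (refl to reflW; sym to symW; trans to transW)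
  open GroupProperties W using (∙-cancelˡ; ∙-cancelʳ)
  open ReflectionFacts C
  open ReflectionLength C fin N ref isEnum
  open TensorAlgebra C N ref K
  open WithC c
  open Orthogonality K C c N ref using (HurwitzInvariant)
  open CommutativeRing K using (0#; 1#; refl; sym; trans; reflexive; *-congˡ; *-identityʳ; zeroʳ)
    renaming (_≈_ to _≈k_; _*_ to _*k_)

  PrecedesAllBelow : Fin N → Carrier → Set
  PrecedesAllBelow a w = ∀ j → j < a → ¬ ref j ≤T w

  PrecedesAllBelow? : ∀ a w → Dec (PrecedesAllBelow a w)
  PrecedesAllBelow? a w = Finₚ.all? λ j → (j Finₚ.<? a) →-dec ¬? (≤T? (ref j) w)

  PrecedesAllBelow-cong : ∀ {a w w′} → w ≈ w′ → PrecedesAllBelow a w → PrecedesAllBelow a w′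
  PrecedesAllBelow-cong w≈w′ least j j<a j≤w′ = least j j<a (≤T-congʳ (symW w≈w′) j≤w′)

  module Cycle (w : Carrier) (w∈NC₂ : NC₂ c w) (m : ℕ) (us : Fin (suc m) → Fin N)
               (us-enum : OrderedEnum (λ t → t ≤T w) m us) where

    prev : Fin (suc m) → Fin (suc m)
    prev q = wrap m (toℕ q + m)

    factorisation : ∀ q → w ≈ ref (us q) ∙ ref (us (prev q))
    factorisation q =
      ≡.subst (λ i → w ≈ ref (us i) ∙ ref (us (prev q))) (wrap-toℕ m q) (compat w w∈NC₂ m us us-enum q)

    us-injective : ∀ {p q} → us p ≡ us q → p ≡ q
    us-injective {p} {q} us≡ with Finₚ.<-cmp p q
    ... | tri< p<q _ _ = ⊥-elim (Finₚ.<-irrefl us≡ (proj₁ us-enum p q p<q))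
    ... | tri≈ _ p≡q _ = p≡q
    ... | tri> _ _ q<p = ⊥-elim (Finₚ.<-irrefl (≡.sym us≡) (proj₁ us-enum q p q<p))

    factor-index : ∀ {x y} → ref x ∙ ref y ≈ w → ∃ λ q → us q ≡ x × us (prev q) ≡ y
    factor-index {x} {y} xy≈w
      with Equivalence.to (proj₂ us-enum x) (reflection≤T (ref-IsRefl x) (ref-IsRefl y) (proj₂ w∈NC₂) xy≈w)
    ... | q , ≡.refl =
      q , ≡.refl , ≡.sym (ref-injective (∙-cancelˡ (ref x) _ _ (transW xy≈w (factorisation q))))

    cycElem-eq : ∀ x y → cycElem m us x y ≈k sumK (suc m) (λ q → e (us q) (us (prev q)) x y)
    cycElem-eq x y = sumK-cong (suc m) λ q → reflexive (≡.cong (λ i → e (us i) (us (prev q)) x y) (wrap-toℕ m q))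

    cycElem-factor : ∀ {x y} → ref x ∙ ref y ≈ w → cycElem m us x y ≈k 1#
    cycElem-factor xy≈w with factor-index xy≈w
    ... | q , ≡.refl , ≡.refl =
      trans (cycElem-eq (us q) (us (prev q))) (trans (sumK-δ (suc m) q others) (e-diag (us q) (us (prev q))))
      where
      others : ∀ p → p ≢ q → e (us p) (us (prev p)) (us q) (us (prev q)) ≈k 0#
      others p p≢q = e-off (us p) (us (prev p)) (us q) (us (prev q)) (p≢q ∘ us-injective ∘ proj₁)

    cycElem-nonfactor : ∀ {x y} → ¬ ref x ∙ ref y ≈ w → cycElem m us x y ≈k 0#
    cycElem-nonfactor {x} {y} xy≉w = trans (cycElem-eq x y) (sumK-zero (suc m) λ q →
      e-off (us q) (us (prev q)) x y λ { (≡.refl , ≡.refl) → xy≉w (symW (factorisation q)) })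

    HurwitzInvariant-factor : ∀ {f} → HurwitzInvariant f →
      ∀ {x y} → ref x ∙ ref y ≈ w → f x y ≈k f (us zero) (us (prev zero))
    HurwitzInvariant-factor {f} inv xy≈w with factor-index xy≈w
    ... | q , ≡.refl , ≡.refl = descend (toℕ q) q ≡.refl
      where
      move : ∀ q → f (us q) (us (prev q)) ≈k f (us (prev q)) (us (prev (prev q)))
      move q = inv _ _ _ (≤T-congˡ (factorisation q) (proj₁ w∈NC₂))
                         (transW (symW (factorisation q)) (factorisation (prev q)))
      descend : ∀ n q → toℕ q ≡ n → f (us q) (us (prev q)) ≈k f (us zero) (us (prev zero))
      descend zero    q q≡0   with Finₚ.toℕ-injective {i = q} {j = zero} q≡0
      ... | ≡.refl = refl
      descend (suc n) q q≡1+n = trans (move q) (descend n (prev q) (toℕ-wrap-pred m q q≡1+n))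

    first-precedesAllBelow : PrecedesAllBelow (us zero) w
    first-precedesAllBelow j j<u₀ j≤w with Equivalence.to (proj₂ us-enum j) j≤w
    ... | zero  , ≡.refl = Finₚ.<-irrefl ≡.refl j<u₀
    ... | suc q , ≡.refl = Finₚ.<-asym j<u₀ (proj₁ us-enum zero (suc q) (ℕ.s≤s ℕ.z≤n))

    precedesAllBelow⇒first-factor : ∀ {a b} → ref a ∙ ref b ≈ w → PrecedesAllBelow a w →
                                    a ≡ us zero × b ≡ us (prev zero)
    precedesAllBelow⇒first-factor ab≈w least with factor-index ab≈w
    ... | zero  , ≡.refl , ≡.refl = ≡.refl , ≡.refl
    ... | suc q , ≡.refl , _      = ⊥-elim (least (us zero) (proj₁ us-enum zero (suc q) (ℕ.s≤s ℕ.z≤n))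
                                      (Equivalence.from (proj₂ us-enum (us zero)) (zero , ≡.refl)))

  reflectionsBelow : ∀ w {j} → ref j ≤T w →
    Σ ℕ λ m → Σ (Fin (suc m) → Fin N) (OrderedEnum (λ t → t ≤T w) m)
  reflectionsBelow w {j} j≤w with enumerate (λ i → ≤T? (ref i) w)
  ... | zero  , us , _    , us-enum with proj₁ (Equivalence.to (us-enum j) j≤w)
  ...   | ()
  reflectionsBelow w j≤w | suc m , us , mono , us-enum = m , us , mono , us-enum

  NC₂Pair : Fin N → Fin N → Set
  NC₂Pair a b = a ≢ b × (ref a ∙ ref b) ≤T c

  NC₂Pair? : ∀ a b → Dec (NC₂Pair a b)
  NC₂Pair? a b = ¬? (a Fin.≟ b) ×-dec ≤T? (ref a ∙ ref b) c

  ≢⇒∙≉ε : ∀ {a b} → a ≢ b → ¬ ref a ∙ ref b ≈ ε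
  ≢⇒∙≉ε {b = b} a≢b ab≈ε = a≢b (ref-injective (∙≈ε⇒≈ (ref-IsRefl b) ab≈ε))

  NC₂Pair⇒NC₂ : ∀ {a b} → NC₂Pair a b → NC₂ c (ref a ∙ ref b)
  NC₂Pair⇒NC₂ {a} {b} (a≢b , ab≤c) =
    ab≤c , ℓT-reflection∙reflection (ref-IsRefl a) (ref-IsRefl b) (≢⇒∙≉ε a≢b)

  NC₂Pair-resp : ∀ {a b a′ b′} → ref a ∙ ref b ≈ ref a′ ∙ ref b′ → NC₂Pair a b → NC₂Pair a′ b′
  NC₂Pair-resp {a′ = a′} ab≈a′b′ (a≢b , ab≤c) =
    (λ { ≡.refl → ≢⇒∙≉ε a≢b (transW ab≈a′b′ (IsRefl-involution (ref-IsRefl a′))) }) ,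
    ≤T-congˡ ab≈a′b′ ab≤c

  pairCycle : ∀ {a b} → NC₂Pair a b →
    Σ ℕ λ m → Σ (Fin (suc m) → Fin N) (OrderedEnum (λ t → t ≤T (ref a ∙ ref b)) m)
  pairCycle {a} {b} nc =
    reflectionsBelow _ (reflection≤T (ref-IsRefl a) (ref-IsRefl b) (proj₂ (NC₂Pair⇒NC₂ nc)) reflW)

  module PairCycle {a b} (nc : NC₂Pair a b) =
    Cycle (ref a ∙ ref b) (NC₂Pair⇒NC₂ nc) (proj₁ (pairCycle nc)) (proj₁ (proj₂ (pairCycle nc)))
          (proj₂ (proj₂ (pairCycle nc)))

  generator : Fin N → Fin N → Tensor
  generator a b with NC₂Pair? a b
  ... | yes nc = cycElem (proj₁ (pairCycle nc)) (proj₁ (proj₂ (pairCycle nc)))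
  ... | no _   = e a b

  generator-DualGen : ∀ a b → DualGen (generator a b)
  generator-DualGen a b with NC₂Pair? a b
  ... | yes nc = inj₂ (inj₂ (_ , _ , _ , NC₂Pair⇒NC₂ nc , proj₂ (proj₂ (pairCycle nc)) , λ _ _ → refl))
  ... | no ¬nc with a Fin.≟ b
  ...   | yes ≡.refl = inj₁ (a , λ _ _ → refl)
  ...   | no a≢b     = inj₂ (inj₁ (a , b , (λ ab≤c → ¬nc (a≢b , ab≤c)) , λ _ _ → refl))

  -- The support of generator a b.
  Linked : Fin N → Fin N → Fin N → Fin N → Set
  Linked a b a′ b′ = (a ≡ a′ × b ≡ b′) ⊎ (NC₂Pair a b × ref a′ ∙ ref b′ ≈ ref a ∙ ref b)

  Linked⇒same-product : ∀ {a b a′ b′} → Linked a b a′ b′ → ref a′ ∙ ref b′ ≈ ref a ∙ ref b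
  Linked⇒same-product (inj₁ (≡.refl , ≡.refl)) = reflW
  Linked⇒same-product (inj₂ (_ , a′b′≈ab))     = a′b′≈ab

  Linked⇒NC₂Pair : ∀ {a b a′ b′} → NC₂Pair a′ b′ → Linked a b a′ b′ → NC₂Pair a b
  Linked⇒NC₂Pair nc′ (inj₁ (≡.refl , ≡.refl)) = nc′
  Linked⇒NC₂Pair _   (inj₂ (nc , _))           = nc

  generator-linked : ∀ {a b a′ b′} → Linked a b a′ b′ → generator a b a′ b′ ≈k 1#
  generator-linked {a} {b} linked with NC₂Pair? a b | linked
  ... | yes nc | _                      = PairCycle.cycElem-factor nc (Linked⇒same-product linked)
  ... | no _   | inj₁ (≡.refl , ≡.refl) = e-diag a b
  ... | no ¬nc | inj₂ (nc , _)          = ⊥-elim (¬nc nc)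

  generator-unlinked : ∀ {a b a′ b′} → ¬ Linked a b a′ b′ → generator a b a′ b′ ≈k 0#
  generator-unlinked {a} {b} {a′} {b′} ¬linked with NC₂Pair? a b
  ... | yes nc = PairCycle.cycElem-nonfactor nc (λ a′b′≈ab → ¬linked (inj₂ (nc , a′b′≈ab)))
  ... | no _   = e-off a b a′ b′ (¬linked ∘ inj₁)

  HurwitzInvariant-Linked : ∀ {f} → HurwitzInvariant f →
                            ∀ {a b a′ b′} → Linked a b a′ b′ → f a b ≈k f a′ b′
  HurwitzInvariant-Linked inv (inj₁ (≡.refl , ≡.refl)) = refl
  HurwitzInvariant-Linked inv (inj₂ (nc , a′b′≈ab))    =
    trans (HurwitzInvariant-factor inv reflW) (sym (HurwitzInvariant-factor inv a′b′≈ab))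
    where open PairCycle nc

  -- Each class of linked pairs is represented by its pair whose first reflection is ≺-least.
  IsRepresentative : Fin N → Fin N → Set
  IsRepresentative a b = NC₂Pair a b → PrecedesAllBelow a (ref a ∙ ref b)

  IsRepresentative? : ∀ a b → Dec (IsRepresentative a b)
  IsRepresentative? a b = NC₂Pair? a b →-dec PrecedesAllBelow? a (ref a ∙ ref b)

  record Representative (a′ b′ : Fin N) : Set where
    field
      a₀ b₀            : Fin N
      isRepresentative : IsRepresentative a₀ b₀
      linked           : Linked a₀ b₀ a′ b′
      unique           : ∀ {a b} → IsRepresentative a b → Linked a b a′ b′ → a ≡ a₀ × b ≡ b₀

  representative : ∀ a′ b′ → Representative a′ b′
  representative a′ b′ with NC₂Pair? a′ b′
  ... | no ¬nc = record
    { a₀ = a′ ; b₀ = b′ ; isRepresentative = ⊥-elim ∘ ¬nc ; linked = inj₁ (≡.refl , ≡.refl)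
    ; unique = λ where
        _ (inj₁ (≡.refl , ≡.refl)) → ≡.refl , ≡.refl
        _ (inj₂ (nc , a′b′≈ab))     → ⊥-elim (¬nc (NC₂Pair-resp (symW a′b′≈ab) nc))
    }
  ... | yes nc = record
    { a₀ = us zero ; b₀ = us (prev zero)
    ; isRepresentative = λ _ → PrecedesAllBelow-cong (factorisation zero) first-precedesAllBelow
    ; linked = inj₂ (NC₂Pair-resp (factorisation zero) nc , factorisation zero)
    ; unique = λ isRep linked → precedesAllBelow⇒first-factor (symW (Linked⇒same-product linked))
                 (PrecedesAllBelow-cong (symW (Linked⇒same-product linked)) (isRep (Linked⇒NC₂Pair nc linked)))
    }
    where
    open PairCycle nc
    us = proj₁ (proj₂ (pairCycle nc))

  DualGen⇒HurwitzInvariant : ∀ {g} → DualGen g → HurwitzInvariant g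
  DualGen⇒HurwitzInvariant {g} gen a b j ab≤c ab≈bj = move gen
    where
    via : ∀ {h} → g ≐ h → h a b ≈k h b j → g a b ≈k g b j
    via g≐h h-move = trans (g≐h a b) (trans h-move (sym (g≐h b j)))

    move : DualGen g → g a b ≈k g b j
    move (inj₁ (x , g≐)) = via g≐ (e-resp x x a b b j (mk⇔ to from))
      where
      to : x ≡ a × x ≡ b → x ≡ b × x ≡ j
      to (≡.refl , ≡.refl) = ≡.refl , ref-injective (∙-cancelˡ (ref x) _ _ ab≈bj)
      from : x ≡ b × x ≡ j → x ≡ a × x ≡ b
      from (≡.refl , ≡.refl) = ≡.sym (ref-injective (∙-cancelʳ (ref x) _ _ ab≈bj)) , ≡.refl
    move (inj₂ (inj₁ (x , y , xy≰c , g≐))) = via g≐ (trans (e-off x y a b ab≢xy) (sym (e-off x y b j bj≢xy)))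
      where
      ab≢xy : ¬ (x ≡ a × y ≡ b)
      ab≢xy (≡.refl , ≡.refl) = xy≰c ab≤c
      bj≢xy : ¬ (x ≡ b × y ≡ j)
      bj≢xy (≡.refl , ≡.refl) = xy≰c (≤T-congˡ ab≈bj ab≤c)
    move (inj₂ (inj₂ (w , m , us , w∈NC₂ , us-enum , g≐))) = via g≐ (cycle-move ((ref a ∙ ref b) ≈? w))
      where
      open Cycle w w∈NC₂ m us us-enum
      cycle-move : Dec (ref a ∙ ref b ≈ w) → cycElem m us a b ≈k cycElem m us b j
      cycle-move (yes ab≈w) = trans (cycElem-factor ab≈w) (sym (cycElem-factor (transW (symW ab≈bj) ab≈w)))
      cycle-move (no ab≉w)  = trans (cycElem-nonfactor ab≉w) (sym (cycElem-nonfactor (ab≉w ∘ transW ab≈bj)))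

  module _ (f : Tensor) where

    summand : Fin N → Fin N → Tensor
    summand a b with IsRepresentative? a b
    ... | yes _ = λ a′ b′ → f a b *k generator a b a′ b′
    ... | no _  = λ _ _ → 0#

    summand-Span : ∀ a b → Span DualGen (summand a b)
    summand-Span a b with IsRepresentative? a b
    ... | yes _ = Span-scaled (f a b) (generator-DualGen a b)
    ... | no _  = Span-zero

    open Representative

    summand-elsewhere : ∀ {a′ b′} (R : Representative a′ b′) a b →
      ¬ (a ≡ a₀ R × b ≡ b₀ R) → summand a b a′ b′ ≈k 0#
    summand-elsewhere R a b ≢ with IsRepresentative? a b
    ... | yes isRep = trans (*-congˡ (generator-unlinked (≢ ∘ unique R isRep))) (zeroʳ (f a b))
    ... | no _      = refl

    summand-at-representative : HurwitzInvariant f → ∀ {a′ b′} (R : Representative a′ b′) →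
      summand (a₀ R) (b₀ R) a′ b′ ≈k f a′ b′
    summand-at-representative inv R with IsRepresentative? (a₀ R) (b₀ R)
    ... | yes _     = trans (*-congˡ (generator-linked (linked R)))
                       (trans (*-identityʳ _) (HurwitzInvariant-Linked inv (linked R)))
    ... | no ¬isRep = ⊥-elim (¬isRep (isRepresentative R))

    HurwitzInvariant⇒Span : HurwitzInvariant f → Span DualGen f
    HurwitzInvariant⇒Span inv = Span-cong f≐Σsummand (Span-sumK N λ a → Span-sumK N λ b → summand-Span a b)
      where
      f≐Σsummand : f ≐ λ a′ b′ → sum² λ a b → summand a b a′ b′
      f≐Σsummand a′ b′ =
        sym (trans (sum²-δ (a₀ R) (b₀ R) (summand-elsewhere R)) (summand-at-representative inv R))
        where R = representative a′ b′

theorem5p1 : (K : CommutativeRing 0ℓ 0ℓ) → IsField K →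
    (C : CoxeterSystem) → IsFiniteCoxeter C →
    let open Cox C in
    (c : Carrier) → IsStandardCoxeterElement c →
    (N : ℕ) (ref : Fin N → Carrier) →
    let open Ordering N ref in
    IsReflectionOrdering → IsCCompatible c →
    let open Lin K in
    let open WithC c in
    (f : Tensor) → InRperp f ⇔ Span DualGen f
theorem5p1 K _ C fin c _ N ref (isEnum , _) compat f = mk⇔
  (λ f⊥R → HurwitzInvariant⇒Span f (InRperp⇒HurwitzInvariant f⊥R))
  (InRperp-Span (λ g g∈DualGen → HurwitzInvariant⇒InRperp (DualGen⇒HurwitzInvariant g∈DualGen)))
  where
  open Orthogonality K C c N ref
  open Decomposition K C fin c N ref isEnum compat
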